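{- Let $G$ be a 3-connected graph and $(A,B)$ a tri-separation of $G$. Then both $G[A]$ and $G[B]$ contain a cycle unless $A$ and $B$ are the two sides of an atomic cut; precisely, $(A,B)$ is trivial (i.e. $G[A]$ or $G[B]$ contains no cycle) if and only if $A$ and $B$ are the two sides of an atomic cut of $G$.
   Context: A mixed-separation of $G$ is an ordered pair $(A,B)$ with $A\cup B=V(G)$ and $A\setminus B$, $B\setminus A$ nonempty; its separator is the disjoint union of $A\cap B$ and $E(A\setminus B,B\setminus A)$. A tri-separation is a mixed-separation with separator of size three such that each vertex of $A\cap B$ has at least two neighbours in $G[A]$ and in $G[B]$. It is trivial if $G[A]$ or $G[B]$ contains no cycle. A cut is atomic if it is $E(\{v\},V(G)\setminus\{v\})$ for some vertex $v$; its sides are $\{v\}$ and $V(G)\setminus\{v\}$. -}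

module Defs where

open import Data.Nat using (ℕ; zero; suc; _+_; _≤_; _<_)
open import Data.Bool using (Bool; true; false; _∧_; _∨_; not; if_then_else_)
open import Data.Fin using (Fin; _≟_)
open import Data.List using (List; []; _∷_; length; map; _∷ʳ_; allFin)
open import Data.Nat.ListAction using (sum)
open import Data.List.Relation.Unary.All using (All)
open import Data.List.Relation.Unary.Linked using (Linked)
open import Data.List.Relation.Unary.Unique.Propositional using (Unique)
open import Data.Product using (Σ; ∃; _×_)
open import Data.Sum using (_⊎_)
open import Data.Unit using (⊤)
open import Relation.Nullary using (¬_)
open import Relation.Nullary.Decidable using (⌊_⌋)
open import Relation.Binary.PropositionalEquality using (_≡_)
open import Function.Bundles using (_⇔_)

record Graph : Set where
  field
    n      : ℕ
    adj    : Fin n → Fin n → Bool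
    sym    : ∀ u v → adj u v ≡ adj v u
    irrefl : ∀ v → adj v v ≡ false
open Graph public

VSet : Graph → Set
VSet G = Fin (n G) → Bool

count : ∀ {m} → (Fin m → Bool) → ℕ
count {m} P = sum (map (λ x → if P x then 1 else 0) (allFin m))

count₂ : ∀ {m} → (Fin m → Fin m → Bool) → ℕ
count₂ {m} R = sum (map (λ u → count (R u)) (allFin m))

data Reach (G : Graph) (S : VSet G) : Fin (n G) → Fin (n G) → Set where
  here : ∀ {u} → Reach G S u u
  step : ∀ {u v w} → adj G u v ≡ true → S v ≡ true → Reach G S v w → Reach G S u w

Connected : (G : Graph) → VSet G → Set
Connected G S = ∀ u v → S u ≡ true → S v ≡ true → Reach G S u v

KConnected : ℕ → Graph → Set
KConnected k G = (k < n G) × (∀ (X : VSet G) → count X < k → Connected G (λ x → not (X x)))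

ThreeConnected : Graph → Set
ThreeConnected = KConnected 3

IsClosed : (G : Graph) → List (Fin (n G)) → Set
IsClosed G []       = ⊤
IsClosed G (x ∷ xs) = Linked (λ u v → adj G u v ≡ true) ((x ∷ xs) ∷ʳ x)

HasCycle : (G : Graph) → VSet G → Set
HasCycle G S = Σ (List (Fin (n G))) λ vs →
  (3 ≤ length vs) × Unique vs × All (λ x → S x ≡ true) vs × IsClosed G vs

IsMixedSeparation : (G : Graph) → VSet G → VSet G → Set
IsMixedSeparation G A B =
  (∀ x → A x ∨ B x ≡ true) ×
  (∃ λ x → A x ∧ not (B x) ≡ true) ×
  (∃ λ x → B x ∧ not (A x) ≡ true)

-- size of the separator: |A ∩ B| + |E(A∖B, B∖A)|.
-- Each edge uv with u ∈ A∖B, v ∈ B∖A is counted once as the ordered pair (u,v).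
separatorSize : (G : Graph) → VSet G → VSet G → ℕ
separatorSize G A B =
  count (λ x → A x ∧ B x) +
  count₂ (λ u v → (A u ∧ not (B u)) ∧ ((B v ∧ not (A v)) ∧ adj G u v))

degIn : (G : Graph) → VSet G → Fin (n G) → ℕ
degIn G S v = count (λ u → S u ∧ adj G v u)

IsTriSeparation : (G : Graph) → VSet G → VSet G → Set
IsTriSeparation G A B =
  IsMixedSeparation G A B ×
  (separatorSize G A B ≡ 3) ×
  (∀ x → A x ∧ B x ≡ true → (2 ≤ degIn G A x) × (2 ≤ degIn G B x))

IsTrivial : (G : Graph) → VSet G → VSet G → Set
IsTrivial G A B = (¬ HasCycle G A) ⊎ (¬ HasCycle G B)

AreSidesOfAtomicCut : (G : Graph) → VSet G → VSet G → Set
AreSidesOfAtomicCut G A B = ∃ λ v →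
  ((∀ x → A x ≡ ⌊ x ≟ v ⌋) × (∀ x → B x ≡ not ⌊ x ≟ v ⌋)) ⊎
  ((∀ x → B x ≡ ⌊ x ≟ v ⌋) × (∀ x → A x ≡ not ⌊ x ≟ v ⌋))

-- At most one vertex of A has fewer than two neighbours in A: such a vertex lies
-- outside the separator, so by 3-connectivity it sends at least two edges to B ∖ A,
-- and two such vertices would give four separator edges. A graph with two vertices,
-- all but at most one of degree ≥ 2, contains a cycle (a maximal greedy path closes
-- up). Hence if G[A] is acyclic, A is a single vertex a ∈ A ∖ B, and B = V(G) ∖ {a}
-- since A ∪ B = V(G). Conversely G[{v}] has no cycle.
module Submission where

open import Defs renaming (sym to adj-sym; irrefl to adj-irrefl)
open import Algebra.Bundles using (CommutativeMonoid)
open import Data.Bool using (Bool; true; false; _∧_; _∨_; not; if_then_else_)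
open import Data.Bool.Properties
  using (∧-commutativeMonoid; ∧-comm; ∨-comm; not-¬; not-involutive)
  renaming (_≟_ to _≟ᵇ_)
open import Data.Fin using (Fin; zero; suc; toℕ; _≟_)
open import Data.Fin.Properties using (any?; injective⇒≤)
open import Data.List using (List; []; _∷_; length; map; _∷ʳ_; allFin; tabulate; lookup; take)
open import Data.List.Properties using (map-tabulate; map-cong)
open import Data.List.Membership.Propositional using (_∈_; _∉_)
open import Data.List.Membership.Propositional.Properties using (∈-lookup)
open import Data.List.Relation.Unary.All as All using (All; []; _∷_)
open import Data.List.Relation.Unary.All.Properties using (¬Any⇒All¬) renaming (take⁺ to All-take⁺)
open import Data.List.Relation.Unary.AllPairs using ([]; _∷_)
open import Data.List.Relation.Unary.Any using (here; there; index)
open import Data.List.Relation.Unary.Linked using (Linked; [-]; _∷_)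
open import Data.List.Relation.Unary.Unique.Propositional using (Unique)
import Data.List.Relation.Unary.Unique.Propositional.Properties as Unique
open import Data.Nat using (ℕ; zero; suc; _+_; _≤_; _<_; z≤n; s≤s; _≤?_)
  renaming (_≟_ to _≟ℕ_)
open import Data.Nat.ListAction using (sum)
open import Data.Nat.Properties
  using ( +-0-commutativeMonoid; ≤-trans; m<m+n; ≤-reflexive; +-mono-≤; +-monoʳ-≤
        ; +-monoˡ-≤; +-comm; +-suc; m≤m+n; m≤n+m; ≰⇒>; <⇒≱; +-cancelˡ-≤; +-cancelʳ-≤
        ; module ≤-Reasoning)
open import Data.Product using (∃; ∃₂; _×_; _,_; proj₁; proj₂; map₂; swap)
open import Data.Sum using (inj₁; inj₂)
open import Function using (_∘_; id; flip)
open import Function.Bundles using (_⇔_; mk⇔)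
open import Relation.Nullary using (¬_; yes; no; contradiction)
open import Relation.Nullary.Decidable using (⌊_⌋; _×-dec_)
open import Relation.Binary.PropositionalEquality
  using (_≡_; _≢_; refl; sym; trans; cong; cong₂; subst)
open import Relation.Binary.PropositionalEquality.Properties using (module ≡-Reasoning)
open import Algebra.Properties.CommutativeMonoid.Sum +-0-commutativeMonoid
  using (sum-syntax; ∑-distrib-+; ∑-comm; sum-cong-≗; sum-replicate-zero)
open import Algebra.Properties.CommutativeSemigroup
  (CommutativeMonoid.commutativeSemigroup ∧-commutativeMonoid) using (x∙yz≈y∙xz)

∧-true⁻ : ∀ {x y} → x ∧ y ≡ true → x ≡ true × y ≡ true
∧-true⁻ {true} y≡true = refl , y≡true

≟-true⇒≡ : ∀ {m} {x y : Fin m} → ⌊ x ≟ y ⌋ ≡ true → x ≡ y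
≟-true⇒≡ {x = x} {y} h with x ≟ y
≟-true⇒≡ _  | yes x≡y = x≡y
≟-true⇒≡ () | no _

≟-false⇒≢ : ∀ {m} {x y : Fin m} → not ⌊ x ≟ y ⌋ ≡ true → x ≢ y
≟-false⇒≢ {x = x} {y} h with x ≟ y
≟-false⇒≢ () | yes _
≟-false⇒≢ _  | no x≢y = x≢y

lookup-injective : ∀ {a} {X : Set a} {xs : List X} → Unique xs →
                   ∀ {i j} → lookup xs i ≡ lookup xs j → i ≡ j
lookup-injective (_  ∷ _) {zero}  {zero}  _  = refl
lookup-injective (x∉ ∷ _) {zero}  {suc j} eq = contradiction eq (All.lookup x∉ (∈-lookup j))
lookup-injective (x∉ ∷ _) {suc i} {zero}  eq = contradiction (sym eq) (All.lookup x∉ (∈-lookup i))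
lookup-injective (_  ∷ u) {suc i} {suc j} eq = cong suc (lookup-injective u eq)

unique⇒length≤ : ∀ {m} {xs : List (Fin m)} → Unique xs → length xs ≤ m
unique⇒length≤ {xs = xs} u = injective⇒≤ {f = lookup xs} (lookup-injective u)

-- Counting

indicator : Bool → ℕ
indicator b = if b then 1 else 0

sum-tabulate : ∀ {m} (f : Fin m → ℕ) → sum (tabulate f) ≡ ∑[ i < m ] f i
sum-tabulate {zero}  f = refl
sum-tabulate {suc m} f = cong (f zero +_) (sum-tabulate (f ∘ suc))

sum-map-allFin : ∀ {m} (f : Fin m → ℕ) → sum (map f (allFin m)) ≡ ∑[ i < m ] f i
sum-map-allFin f = trans (cong sum (map-tabulate id f)) (sum-tabulate f)

count≡∑ : ∀ {m} (P : Fin m → Bool) → count P ≡ ∑[ i < m ] indicator (P i)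
count≡∑ P = sum-map-allFin (indicator ∘ P)

count₂≡∑ : ∀ {m} (R : Fin m → Fin m → Bool) → count₂ R ≡ ∑[ i < m ] count (R i)
count₂≡∑ R = sum-map-allFin (count ∘ R)

∑-mono-≤ : ∀ {m} {f g : Fin m → ℕ} → (∀ i → f i ≤ g i) → ∑[ i < m ] f i ≤ ∑[ i < m ] g i
∑-mono-≤ {zero}  _   = z≤n
∑-mono-≤ {suc m} f≤g = +-mono-≤ (f≤g zero) (∑-mono-≤ (f≤g ∘ suc))

term≤∑ : ∀ {m} (f : Fin m → ℕ) i → f i ≤ ∑[ j < m ] f j
term≤∑ f zero    = m≤m+n _ _
term≤∑ f (suc i) = ≤-trans (term≤∑ (f ∘ suc) i) (m≤n+m _ _)

twoTerms≤∑ : ∀ {m} (f : Fin m → ℕ) {i j} → i ≢ j → f i + f j ≤ ∑[ k < m ] f k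
twoTerms≤∑ f {zero}  {zero}  i≢j = contradiction refl i≢j
twoTerms≤∑ f {zero}  {suc j} _   = +-monoʳ-≤ (f zero) (term≤∑ (f ∘ suc) j)
twoTerms≤∑ f {suc i} {zero}  _   =
  ≤-trans (≤-reflexive (+-comm (f (suc i)) (f zero))) (+-monoʳ-≤ (f zero) (term≤∑ (f ∘ suc) i))
twoTerms≤∑ f {suc i} {suc j} i≢j = ≤-trans (twoTerms≤∑ (f ∘ suc) (i≢j ∘ cong suc)) (m≤n+m _ _)

∑-ones : ∀ m → ∑[ i < m ] 1 ≡ m
∑-ones zero    = refl
∑-ones (suc m) = cong suc (∑-ones m)

count-cong : ∀ {m} {P Q : Fin m → Bool} → (∀ x → P x ≡ Q x) → count P ≡ count Q
count-cong P≗Q = cong sum (map-cong (cong indicator ∘ P≗Q) (allFin _))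

count₂-cong : ∀ {m} {R S : Fin m → Fin m → Bool} → (∀ u v → R u v ≡ S u v) → count₂ R ≡ count₂ S
count₂-cong R≗S = cong sum (map-cong (count-cong ∘ R≗S) (allFin _))

count₂-transpose : ∀ {m} (R : Fin m → Fin m → Bool) → count₂ R ≡ count₂ (flip R)
count₂-transpose {m} R = begin
  count₂ R                                         ≡⟨ count₂≡∑ R ⟩
  ∑[ u < m ] count (R u)                           ≡⟨ sum-cong-≗ (count≡∑ ∘ R) ⟩
  ∑[ u < m ] ∑[ v < m ] indicator (R u v)          ≡⟨ ∑-comm (λ u v → indicator (R u v)) ⟩
  ∑[ v < m ] ∑[ u < m ] indicator (R u v)          ≡⟨ sum-cong-≗ (sym ∘ count≡∑ ∘ flip R) ⟩
  ∑[ v < m ] count (flip R v)                      ≡⟨ count₂≡∑ (flip R) ⟨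
  count₂ (flip R)                                  ∎
  where open ≡-Reasoning

count-+-count-not : ∀ {m} (P : Fin m → Bool) → count P + count (not ∘ P) ≡ m
count-+-count-not {m} P = begin
  count P + count (not ∘ P)                            ≡⟨ cong₂ _+_ (count≡∑ P) (count≡∑ (not ∘ P)) ⟩
  ∑[ i < m ] indicator (P i) + ∑[ i < m ] indicator (not (P i))
    ≡⟨ ∑-distrib-+ (indicator ∘ P) (indicator ∘ not ∘ P) ⟨
  ∑[ i < m ] (indicator (P i) + indicator (not (P i))) ≡⟨ sum-cong-≗ (indicator-+-not ∘ P) ⟩
  ∑[ i < m ] 1                                         ≡⟨ ∑-ones m ⟩
  m                                                    ∎
  where
  open ≡-Reasoning
  indicator-+-not : ∀ b → indicator b + indicator (not b) ≡ 1
  indicator-+-not true  = refl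
  indicator-+-not false = refl

count-≟ : ∀ {m} (p : Fin m) → count (λ x → ⌊ x ≟ p ⌋) ≡ 1
count-≟ p = trans (count≡∑ (λ x → ⌊ x ≟ p ⌋)) (∑-≟ p)
  where
  ∑-≟ : ∀ {m} (p : Fin m) → ∑[ x < m ] indicator ⌊ x ≟ p ⌋ ≡ 1
  ∑-≟ {suc m} zero    = cong suc (sum-replicate-zero m)
  ∑-≟ {suc m} (suc p) = trans (sum-cong-≗ {m} (λ x → cong indicator (≟-suc x p))) (∑-≟ p)
    where
    ≟-suc : ∀ {m} (x y : Fin m) → ⌊ suc x ≟ suc y ⌋ ≡ ⌊ x ≟ y ⌋
    ≟-suc x y with x ≟ y
    ... | yes _ = refl
    ... | no  _ = refl

count-cover : ∀ {m} {P Q R : Fin m → Bool} → (∀ x → P x ≡ true → Q x ∨ R x ≡ true) →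
              count P ≤ count Q + count R
count-cover {m} {P} {Q} {R} cover = begin
  count P                                              ≡⟨ count≡∑ P ⟩
  ∑[ i < m ] indicator (P i)                           ≤⟨ ∑-mono-≤ (λ i → indicator-cover {P i} {Q i} {R i} (cover i)) ⟩
  ∑[ i < m ] (indicator (Q i) + indicator (R i))       ≡⟨ ∑-distrib-+ (indicator ∘ Q) (indicator ∘ R) ⟩
  ∑[ i < m ] indicator (Q i) + ∑[ i < m ] indicator (R i) ≡⟨ cong₂ _+_ (count≡∑ Q) (count≡∑ R) ⟨
  count Q + count R                                    ∎
  where
  open ≤-Reasoning
  indicator-cover : ∀ {p q r} → (p ≡ true → q ∨ r ≡ true) → indicator p ≤ indicator q + indicator r
  indicator-cover {false}                 _ = z≤n
  indicator-cover {true} {true}           _ = s≤s z≤n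
  indicator-cover {true} {false} {true}   _ = s≤s z≤n
  indicator-cover {true} {false} {false} h with () ← h refl

true⇒count≥1 : ∀ {m} {P : Fin m → Bool} {x} → P x ≡ true → 1 ≤ count P
true⇒count≥1 {m} {P} {x} Px = begin
  1                          ≡⟨ cong indicator Px ⟨
  indicator (P x)            ≤⟨ term≤∑ (indicator ∘ P) x ⟩
  ∑[ i < m ] indicator (P i) ≡⟨ count≡∑ P ⟨
  count P                    ∎
  where open ≤-Reasoning

count≥1⇒∃ : ∀ {m} (P : Fin m → Bool) → 1 ≤ count P → ∃ λ x → P x ≡ true
count≥1⇒∃ P pos = ∑-pos⇒∃ P (subst (1 ≤_) (count≡∑ P) pos)
  where
  ∑-pos⇒∃ : ∀ {m} (P : Fin m → Bool) → 1 ≤ ∑[ i < m ] indicator (P i) → ∃ λ x → P x ≡ true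
  ∑-pos⇒∃ {suc m} P pos with P zero in P0
  ... | true  = zero , P0
  ... | false = map₁suc (∑-pos⇒∃ (P ∘ suc) pos)
    where
    map₁suc : (∃ λ x → P (suc x) ≡ true) → ∃ λ x → P x ≡ true
    map₁suc (x , Px) = suc x , Px

count≥2⇒∃≢ : ∀ {m} (P : Fin m → Bool) → 2 ≤ count P → ∀ p → ∃ λ x → P x ≡ true × x ≢ p
count≥2⇒∃≢ P two p =
  let x , Px∧x≢p = count≥1⇒∃ (λ x → P x ∧ not ⌊ x ≟ p ⌋) othersPositive
      Px , x≢p   = ∧-true⁻ Px∧x≢p
  in x , Px , ≟-false⇒≢ x≢p
  where
  split : ∀ x → P x ≡ true → (P x ∧ not ⌊ x ≟ p ⌋) ∨ ⌊ x ≟ p ⌋ ≡ true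
  split x Px with x ≟ p
  ... | yes _ = subst (λ b → (b ∧ false) ∨ true ≡ true) (sym Px) refl
  ... | no  _ = subst (λ b → (b ∧ true) ∨ false ≡ true) (sym Px) refl
  othersPositive : 1 ≤ count (λ x → P x ∧ not ⌊ x ≟ p ⌋)
  othersPositive = +-cancelʳ-≤ 1 1 _ (begin
    2                                                    ≤⟨ two ⟩
    count P                                              ≤⟨ count-cover split ⟩
    count (λ x → P x ∧ not ⌊ x ≟ p ⌋) + count (λ x → ⌊ x ≟ p ⌋)
      ≡⟨ cong (count (λ x → P x ∧ not ⌊ x ≟ p ⌋) +_) (count-≟ p) ⟩
    count (λ x → P x ∧ not ⌊ x ≟ p ⌋) + 1                ∎)
    where open ≤-Reasoning

-- Degrees, paths and cycles

Adjacent : (G : Graph) → Fin (n G) → Fin (n G) → Set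
Adjacent G u v = adj G u v ≡ true

IsPathIn : (G : Graph) → VSet G → List (Fin (n G)) → Set
IsPathIn G A xs = Unique xs × Linked (Adjacent G) xs × All (λ x → A x ≡ true) xs

AtMostOneLowDegree : (G : Graph) → VSet G → Set
AtMostOneLowDegree G A = ∀ {s t} → A s ≡ true → A t ≡ true →
  degIn G A s ≤ 1 → degIn G A t ≤ 1 → s ≡ t

cross : (G : Graph) → VSet G → VSet G → Fin (n G) → Fin (n G) → Bool
cross G A B u v = (A u ∧ not (B u)) ∧ ((B v ∧ not (A v)) ∧ adj G u v)

module _ (G : Graph) where

  open import Data.List.Membership.DecPropositional (_≟_ {n G}) using (_∈?_)

  adj⇒≢ : ∀ {u v} → adj G u v ≡ true → u ≢ v
  adj⇒≢ {u} u~v refl with () ← trans (sym (adj-irrefl G u)) u~v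

  ¬reach-avoiding-neighbours : ∀ {a x} → x ≢ a → ¬ Reach G (λ y → not (adj G a y)) a x
  ¬reach-avoiding-neighbours x≢a here                = x≢a refl
  ¬reach-avoiding-neighbours _   (step a~v v∉N[a] _) = not-¬ (sym a~v) (sym v∉N[a])

  -- Deleting the fewer than k neighbours of a would separate a from a non-neighbour.
  kConnected⇒minDegree : ∀ {k} → KConnected k G → ∀ a → k ≤ count (adj G a)
  kConnected⇒minDegree {k} (k<n , connected) a with k ≤? count (adj G a)
  ... | yes k≤deg = k≤deg
  ... | no  k≰deg =
    let x , x∉N[a] , x≢a = count≥2⇒∃≢ (not ∘ adj G a) nonNeighbours≥2 a
    in contradiction (connected (adj G a) (≰⇒> k≰deg) a x (cong not (adj-irrefl G a)) x∉N[a])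
                     (¬reach-avoiding-neighbours x≢a)
    where
    open ≤-Reasoning
    d = count (adj G a)
    nonNeighbours≥2 : 2 ≤ count (not ∘ adj G a)
    nonNeighbours≥2 = +-cancelˡ-≤ d 2 _ (begin
      d + 2                         ≡⟨ +-comm d 2 ⟩
      2 + d                         ≤⟨ ≤-trans (s≤s (≰⇒> k≰deg)) k<n ⟩
      n G                           ≡⟨ count-+-count-not (adj G a) ⟨
      d + count (not ∘ adj G a)     ∎)

  neighbour⇒degIn≥1 : ∀ {A : VSet G} {u x} → A x ≡ true → adj G u x ≡ true → 1 ≤ degIn G A u
  neighbour⇒degIn≥1 {A} {u} x∈A u~x = true⇒count≥1 {P = λ v → A v ∧ adj G u v} (cong₂ _∧_ x∈A u~x)

  degIn≥1⇒neighbour : ∀ {A : VSet G} {u} → 1 ≤ degIn G A u → ∃ λ t → A t ≡ true × adj G t u ≡ true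
  degIn≥1⇒neighbour {A} {u} pos =
    let t , t∈A∧u~t = count≥1⇒∃ (λ t → A t ∧ adj G u t) pos
        t∈A , u~t   = ∧-true⁻ t∈A∧u~t
    in t , t∈A , trans (adj-sym G t u) u~t

  private
    linked-close : ∀ {w u} x {xs} → Linked (Adjacent G) (x ∷ xs) → (u∈xs : u ∈ xs) → Adjacent G u w →
                   Linked (Adjacent G) ((x ∷ take (suc (toℕ (index u∈xs))) xs) ∷ʳ w)
    linked-close x (x~y ∷ _) (here refl) u~w = x~y ∷ u~w ∷ [-]
    linked-close x (x~y ∷ l) (there u∈xs) u~w = x~y ∷ linked-close _ l u∈xs u~w

    take-nonempty : ∀ {u} {xs : List (Fin (n G))} → u ∈ xs → ∀ k → 1 ≤ length (take (suc k) xs)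
    take-nonempty (here _)  _ = s≤s z≤n
    take-nonempty (there _) _ = s≤s z≤n

  -- A neighbour u of w further back than the second vertex closes the path w, p, …, u to a cycle.
  closePath : ∀ {A w p rest u} → IsPathIn G A (w ∷ p ∷ rest) → (u∈rest : u ∈ rest) →
              adj G u w ≡ true → HasCycle G A
  closePath {w = w} {p} {rest} (unique , linked , inA) u∈rest u~w =
    take k (w ∷ p ∷ rest) ,
    s≤s (s≤s (take-nonempty u∈rest _)) ,
    Unique.take⁺ k unique ,
    All-take⁺ k inA ,
    linked-close w linked (there u∈rest) u~w
    where k = 3 + toℕ (index u∈rest)

  -- Every new endpoint has degree ≥ 2 in A, so it has a
  -- neighbour other than its predecessor; the fuel bounds the number of extensions
  -- by n G, since a path has distinct vertices.
  extendPath⇒HasCycle :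
    ∀ {A} fuel {w p rest} → n G < fuel + length (w ∷ p ∷ rest) →
    IsPathIn G A (w ∷ p ∷ rest) → 2 ≤ degIn G A w →
    (∀ u → A u ≡ true → u ∉ w ∷ p ∷ rest → 1 ≤ degIn G A u → 2 ≤ degIn G A u) →
    HasCycle G A
  extendPath⇒HasCycle zero bound (unique , _) _ _ = contradiction (unique⇒length≤ unique) (<⇒≱ bound)
  extendPath⇒HasCycle {A} (suc fuel) {w} {p} {rest} bound path@(unique , linked , inA) deg-w branching
    with count≥2⇒∃≢ (λ u → A u ∧ adj G w u) deg-w p
  ... | u , u∈A∧w~u , u≢p with ∧-true⁻ u∈A∧w~u
  ... | u∈A , w~u with u ∈? w ∷ p ∷ rest
  ... | yes (here refl)              = contradiction refl (adj⇒≢ w~u)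
  ... | yes (there (here refl))      = contradiction refl u≢p
  ... | yes (there (there u∈rest))   = closePath path u∈rest u~w
    where u~w = trans (adj-sym G u w) w~u
  ... | no u∉path =
    extendPath⇒HasCycle fuel (subst (n G <_) (sym (+-suc fuel _)) bound)
      (¬Any⇒All¬ _ u∉path ∷ unique , u~w ∷ linked , u∈A ∷ inA)
      (branching u u∈A u∉path (neighbour⇒degIn≥1 (All.head inA) u~w))
      (λ x x∈A x∉ → branching x x∈A (x∉ ∘ there))
    where u~w = trans (adj-sym G u w) w~u

  atMostOneLowDegree⇒high : ∀ {A s x} → AtMostOneLowDegree G A → A s ≡ true → degIn G A s ≤ 1 →
                            A x ≡ true → x ≢ s → 2 ≤ degIn G A x
  atMostOneLowDegree⇒high {A} {s} {x} oneLow s∈A s-low x∈A x≢s with degIn G A x ≤? 1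
  ... | yes x-low  = contradiction (oneLow x∈A s∈A x-low s-low) x≢s
  ... | no  x-high = ≰⇒> x-high

  edgePath⇒HasCycle : ∀ {A t s} → adj G t s ≡ true → A t ≡ true → A s ≡ true → 2 ≤ degIn G A t →
                      (∀ x → A x ≡ true → x ∉ t ∷ s ∷ [] → 1 ≤ degIn G A x → 2 ≤ degIn G A x) →
                      HasCycle G A
  edgePath⇒HasCycle t~s t∈A s∈A =
    extendPath⇒HasCycle (n G) (m<m+n (n G) (s≤s z≤n))
      ((adj⇒≢ t~s ∷ []) ∷ [] ∷ [] , t~s ∷ [-] , t∈A ∷ s∈A ∷ [])

  atMostOneLowDegree⇒HasCycle : ∀ {A u v} → AtMostOneLowDegree G A → u ≢ v →
                                A u ≡ true → A v ≡ true → HasCycle G A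
  atMostOneLowDegree⇒HasCycle {A} {u} {v} oneLow u≢v u∈A v∈A
    with any? (λ s → (A s ≟ᵇ true) ×-dec (degIn G A s ≟ℕ 1))
  ... | yes (s , s∈A , deg-s≡1) =
    let t , t∈A , t~s = degIn≥1⇒neighbour (≤-reflexive (sym deg-s≡1))
        s-low         = ≤-reflexive deg-s≡1
    in edgePath⇒HasCycle t~s t∈A s∈A (atMostOneLowDegree⇒high oneLow s∈A s-low t∈A (adj⇒≢ t~s))
         (λ x x∈A x∉ _ → atMostOneLowDegree⇒high oneLow s∈A s-low x∈A (x∉ ∘ there ∘ here))
  ... | no noLeaf =
    let g , g∈A , deg-g≥2 = highVertex
        t , t∈A , t~g     = degIn≥1⇒neighbour (≤-trans (s≤s z≤n) deg-g≥2)
    in edgePath⇒HasCycle t~g t∈A g∈A (noLeaf⇒high t∈A (neighbour⇒degIn≥1 g∈A t~g))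
         (λ x x∈A _ → noLeaf⇒high x∈A)
    where
    noLeaf⇒high : ∀ {x} → A x ≡ true → 1 ≤ degIn G A x → 2 ≤ degIn G A x
    noLeaf⇒high {x} x∈A pos with degIn G A x in deg-x
    ... | suc (suc _) = s≤s (s≤s z≤n)
    ... | suc zero    = contradiction (x , x∈A , deg-x) noLeaf
    highVertex : ∃ λ g → A g ≡ true × 2 ≤ degIn G A g
    highVertex with degIn G A u ≤? 1
    ... | yes u-low  = v , v∈A , atMostOneLowDegree⇒high oneLow u∈A u-low v∈A (u≢v ∘ sym)
    ... | no  u-high = u , u∈A , ≰⇒> u-high

  HasCycle⇒twoVertices : ∀ {C} → HasCycle G C → ∃₂ λ x y → x ≢ y × C x ≡ true × C y ≡ true
  HasCycle⇒twoVertices ([]    , ()     , _)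
  HasCycle⇒twoVertices (_ ∷ [] , s≤s () , _)
  HasCycle⇒twoVertices (x ∷ y ∷ _ , _ , (x∉ ∷ _) , (x∈C ∷ y∈C ∷ _) , _) = x , y , All.head x∉ , x∈C , y∈C

  singleton⇒¬HasCycle : ∀ {C} v → (∀ x → C x ≡ ⌊ x ≟ v ⌋) → ¬ HasCycle G C
  singleton⇒¬HasCycle {C} v C≡[v] cycle =
    let x , y , x≢y , x∈C , y∈C = HasCycle⇒twoVertices cycle
    in x≢y (trans (≟-true⇒≡ (trans (sym (C≡[v] x)) x∈C)) (sym (≟-true⇒≡ (trans (sym (C≡[v] y)) y∈C))))

-- Tri-separations

module _ (G : Graph) where

  separatorSize-swap : ∀ A B → separatorSize G B A ≡ separatorSize G A B
  separatorSize-swap A B =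
    cong₂ _+_ (count-cong (λ x → ∧-comm (B x) (A x)))
              (trans (count₂-cong cross-transpose) (sym (count₂-transpose (cross G A B))))
    where
    cross-transpose : ∀ u v → cross G B A u v ≡ cross G A B v u
    cross-transpose u v = trans (x∙yz≈y∙xz (B u ∧ not (A u)) (A v ∧ not (B v)) (adj G u v))
      (cong (λ e → (A v ∧ not (B v)) ∧ ((B u ∧ not (A u)) ∧ e)) (adj-sym G u v))

  triSeparation-swap : ∀ {A B} → IsTriSeparation G A B → IsTriSeparation G B A
  triSeparation-swap {A} {B} ((covers , a∈A∖B , b∈B∖A) , size , degrees) =
    ((λ x → trans (∨-comm (B x) (A x)) (covers x)) , b∈B∖A , a∈A∖B) ,
    trans (separatorSize-swap A B) size ,
    λ x x∈B∩A → swap (degrees x (trans (∧-comm (A x) (B x)) x∈B∩A))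

module TriSeparation (G : Graph) (A B : VSet G) (tri : IsTriSeparation G A B) where

  covers : ∀ x → A x ∨ B x ≡ true
  covers = proj₁ (proj₁ tri)

  A∖B-nonempty : ∃ λ a → A a ∧ not (B a) ≡ true
  A∖B-nonempty = proj₁ (proj₂ (proj₁ tri))

  separatorDegrees : ∀ x → A x ∧ B x ≡ true → 2 ≤ degIn G A x × 2 ≤ degIn G B x
  separatorDegrees = proj₂ (proj₂ tri)

  crossEdges≤3 : count₂ (cross G A B) ≤ 3
  crossEdges≤3 = subst (count₂ (cross G A B) ≤_) (proj₁ (proj₂ tri)) (m≤n+m _ _)

  lowDegree⇒∉B : ∀ {s} → A s ≡ true → degIn G A s ≤ 1 → B s ≡ false
  lowDegree⇒∉B {s} s∈A s-low with B s in s∈B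
  ... | false = refl
  ... | true  = contradiction (proj₁ (separatorDegrees s (cong₂ _∧_ s∈A s∈B))) (<⇒≱ (s≤s s-low))

  neighbour-in-A-or-cross : ∀ {s} → A s ∧ not (B s) ≡ true → ∀ v → adj G s v ≡ true →
                            (A v ∧ adj G s v) ∨ cross G A B s v ≡ true
  neighbour-in-A-or-cross {s} s∈A∖B v s~v =
    split (A s) (B s) (A v) (B v) (adj G s v) s∈A∖B (covers v) s~v
    where
    split : ∀ as bs av bv e → as ∧ not bs ≡ true → av ∨ bv ≡ true → e ≡ true →
            (av ∧ e) ∨ ((as ∧ not bs) ∧ ((bv ∧ not av) ∧ e)) ≡ true
    split true  false true  _     true  _  _  _  = refl
    split true  false false true  true  _  _  _  = refl
    split true  false false false _     _  () _
    split true  false _     _     false _  _  ()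
    split true  true  _     _     _     () _  _
    split false _     _     _     _     () _  _

  lowDegree⇒crossDegree≥2 : (∀ v → 3 ≤ count (adj G v)) → ∀ {s} → A s ≡ true → degIn G A s ≤ 1 →
                            2 ≤ count (cross G A B s)
  lowDegree⇒crossDegree≥2 minDegree {s} s∈A s-low = +-cancelˡ-≤ 1 2 _ (begin
    3                                    ≤⟨ minDegree s ⟩
    count (adj G s)                      ≤⟨ count-cover (neighbour-in-A-or-cross s∈A∖B) ⟩
    degIn G A s + count (cross G A B s)  ≤⟨ +-monoˡ-≤ _ s-low ⟩
    1 + count (cross G A B s)            ∎)
    where
    open ≤-Reasoning
    s∈A∖B : A s ∧ not (B s) ≡ true
    s∈A∖B = cong₂ _∧_ s∈A (cong not (lowDegree⇒∉B s∈A s-low))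

  atMostOneLowDegree : (∀ v → 3 ≤ count (adj G v)) → AtMostOneLowDegree G A
  atMostOneLowDegree minDegree {s} {t} s∈A t∈A s-low t-low with s ≟ t
  ... | yes s≡t = s≡t
  ... | no  s≢t = contradiction crossEdges≤3 (<⇒≱ (begin
    2 + 2                                            ≤⟨ +-mono-≤ (crossDegree s∈A s-low) (crossDegree t∈A t-low) ⟩
    count (cross G A B s) + count (cross G A B t)    ≤⟨ twoTerms≤∑ (count ∘ cross G A B) s≢t ⟩
    ∑[ u < n G ] count (cross G A B u)               ≡⟨ count₂≡∑ (cross G A B) ⟨
    count₂ (cross G A B)                             ∎))
    where
    open ≤-Reasoning
    crossDegree = lowDegree⇒crossDegree≥2 minDegree

  acyclic⇒singleton : (∀ v → 3 ≤ count (adj G v)) → ¬ HasCycle G A →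
                      ∃ λ v → (∀ x → A x ≡ ⌊ x ≟ v ⌋) × (∀ x → B x ≡ not ⌊ x ≟ v ⌋)
  acyclic⇒singleton minDegree acyclic with A∖B-nonempty
  ... | a , a∈A∖B = a , A≡[a] , B≡V∖[a]
    where
    a∈A = proj₁ (∧-true⁻ a∈A∖B)
    onlyA : ∀ x → x ≢ a → A x ≡ false
    onlyA x x≢a with A x in x∈A
    ... | false = refl
    ... | true  = contradiction
      (atMostOneLowDegree⇒HasCycle G (atMostOneLowDegree minDegree) x≢a x∈A a∈A) acyclic
    A≡[a] : ∀ x → A x ≡ ⌊ x ≟ a ⌋
    A≡[a] x with x ≟ a
    ... | yes refl = a∈A
    ... | no  x≢a  = onlyA x x≢a
    B≡V∖[a] : ∀ x → B x ≡ not ⌊ x ≟ a ⌋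
    B≡V∖[a] x with x ≟ a
    ... | yes refl = trans (sym (not-involutive (B a))) (cong not (proj₂ (∧-true⁻ a∈A∖B)))
    ... | no  x≢a  = subst (λ b → b ∨ B x ≡ true) (onlyA x x≢a) (covers x)

mainTheorem4 : (G : Graph) → ThreeConnected G → (A B : VSet G) →
    IsTriSeparation G A B → (IsTrivial G A B ⇔ AreSidesOfAtomicCut G A B)
mainTheorem4 G threeConnected A B tri = mk⇔ trivial⇒atomic atomic⇒trivial
  where
  minDegree = kConnected⇒minDegree G threeConnected

  trivial⇒atomic : IsTrivial G A B → AreSidesOfAtomicCut G A B
  trivial⇒atomic (inj₁ acyclicA) =
    map₂ inj₁ (TriSeparation.acyclic⇒singleton G A B tri minDegree acyclicA)
  trivial⇒atomic (inj₂ acyclicB) =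
    map₂ inj₂ (TriSeparation.acyclic⇒singleton G B A (triSeparation-swap G tri) minDegree acyclicB)

  atomic⇒trivial : AreSidesOfAtomicCut G A B → IsTrivial G A B
  atomic⇒trivial (v , inj₁ (A≡[v] , _)) = inj₁ (singleton⇒¬HasCycle G v A≡[v])
  atomic⇒trivial (v , inj₂ (B≡[v] , _)) = inj₂ (singleton⇒¬HasCycle G v B≡[v])
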